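{- Let $G$ be a finite, simple, connected, undirected graph of order $n \ge 3$ with minimum degree $\delta(G)$, and let $f: V(G_1) \rightarrow V(G_2)$ be any function, where $G_1, G_2$ are disjoint copies of $G$. Then $$1+\delta(G) \le Z(C(G,f)) \le 2n-2.$$ Moreover, both bounds are sharp: each of them is attained by $C(G,f)$ for some such graph $G$ and some such function $f$.
   Context: Zero forcing: color each vertex of a graph $H$ black or white, with $S$ the initial set of black vertices. The color-change rule turns a white vertex $u_2$ black if $u_2$ is the only white neighbor of some black vertex $u_1$. $S$ is a zero forcing set of $H$ if all vertices become black after finitely many applications of the rule. The zero forcing number $Z(H)$ is the minimum size of a zero forcing set of $H$. Functigraph: given disjoint copies $G_1,G_2$ of a graph $G$ and a function $f:V(G_1)\to V(G_2)$, $C(G,f)$ is the graph with vertex set $V(G_1)\cup V(G_2)$ and edge set $E(G_1)\cup E(G_2)\cup\{uv \mid v=f(u)\}$. -}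

module Defs where

open import Data.Nat using (ℕ; zero; suc; _+_; _⊓_; _≤_)
open import Data.Bool using (Bool; true; false)
open import Data.Fin using (Fin; splitAt; _≟_)
open import Data.Fin.Subset using (Subset; _∈_; ∣_∣)
open import Data.Sum using (inj₁; inj₂)
open import Data.Product using (Σ; _×_)
open import Data.List using (foldr; map)
open import Data.List using () renaming (allFin to allFinL)
open import Data.Vec using (tabulate)
open import Relation.Binary.PropositionalEquality using (_≡_; _≢_)
open import Relation.Nullary.Decidable using (⌊_⌋)

Adj : ℕ → Set
Adj n = Fin n → Fin n → Bool

record IsSimple {n : ℕ} (A : Adj n) : Set where
  field
    sym    : ∀ i j → A i j ≡ A j i
    irrefl : ∀ i → A i i ≡ false

data Walk {n : ℕ} (A : Adj n) : Fin n → Fin n → Set where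
  here : ∀ {u} → Walk A u u
  step : ∀ {u v w} → A u v ≡ true → Walk A v w → Walk A u w

Connected : {n : ℕ} → Adj n → Set
Connected A = ∀ u v → Walk A u v

deg : {n : ℕ} → Adj n → Fin n → ℕ
deg A v = ∣ tabulate (A v) ∣

minDeg : {n : ℕ} → Adj n → ℕ
minDeg {zero}  A = 0
minDeg {suc m} A = foldr _⊓_ (deg A Fin.zero) (map (deg A) (allFinL (suc m)))
  where import Data.Fin as Fin

-- Zero forcing: Black A S v  means v is black after finitely many
-- applications of the colour-change rule starting from the black set S.
data Black {n : ℕ} (A : Adj n) (S : Subset n) : Fin n → Set where
  init  : ∀ {v} → v ∈ S → Black A S v
  force : ∀ {u v} → Black A S u → A u v ≡ true
        → (∀ w → A u w ≡ true → w ≢ v → Black A S w)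
        → Black A S v

IsZeroForcingSet : {n : ℕ} → Adj n → Subset n → Set
IsZeroForcingSet A S = ∀ v → Black A S v

IsZeroForcingNumber : {n : ℕ} → Adj n → ℕ → Set
IsZeroForcingNumber {n} A k =
  Σ (Subset n) (λ S → IsZeroForcingSet A S × ∣ S ∣ ≡ k)
  × (∀ (S : Subset n) → IsZeroForcingSet A S → k ≤ ∣ S ∣)

-- Functigraph C(G,f) on Fin (n + n): vertices  inject+ n i  form the copy G₁,
-- vertices  raise n i  form the copy G₂ (splitAt n separates them);
-- f : V(G₁) → V(G₂) is given as a function Fin n → Fin n.
functigraph : {n : ℕ} → Adj n → (Fin n → Fin n) → Adj (n + n)
functigraph {n} A f x y with splitAt n x | splitAt n y
... | inj₁ a | inj₁ b = A a b
... | inj₂ a | inj₂ b = A a b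
... | inj₁ a | inj₂ b = ⌊ f a ≟ b ⌋
... | inj₂ a | inj₁ b = ⌊ f b ≟ a ⌋

-- Upper bound: leave one vertex i of G₁ and its image f i ∈ G₂ white.  A G₂-neighbour of f i
-- forces f i, which then forces i.
--
-- Lower bound: run the forces of a zero forcing set S in chronological order and watch the set Φ
-- of black vertices that lie in G₁ or still have a white neighbour.  A force by a vertex of G₂
-- never increases ∣Φ∣: the forcer leaves Φ and only the forced vertex can enter.  A vertex i of
-- G₁ can only force when ∣Φ∣ > δ: its closed neighbourhood in G₁, except the forced vertex, is
-- black, and when the forced vertex k is in G₁, f i is black too, so some black vertex of G₂ must
-- keep a white neighbour (otherwise blackness would spread through the connected copy G₂ up to
-- f k, whose neighbour k is white).  At the end all of G₁ lies in Φ and δ < n, so ∣S∣ ≤ δ is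
-- impossible.
--
-- Sharpness: P₃ with f the identity, and K₃ with f constant, where the absence of a zero forcing
-- set of size 3 is decided by running the propagation on all 64 vertex subsets.

module Submission where

open import Defs
open import Data.Bool using (true; false; not)
import Data.Bool as Bool
open import Data.Empty using (⊥-elim)
open import Data.Fin using (Fin; zero; suc; _↑ˡ_; _↑ʳ_; splitAt; _≟_)
open import Data.Fin.Properties
  using (splitAt-↑ˡ; splitAt-↑ʳ; join-splitAt; ↑ˡ-injective; ↑ʳ-injective; any?; all?)
open import Data.Fin.Subset
open import Data.Fin.Subset.Properties
open import Data.List using (foldr) renaming (_∷_ to _∷ₗ_; map to mapₗ; allFin to allFinL)
open import Data.List.Membership.Propositional using () renaming (_∈_ to _∈ₗ_)
open import Data.List.Membership.Propositional.Properties using (∈-allFin)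
import Data.List.Relation.Unary.Any as Any
open import Data.Nat using (ℕ; zero; suc; _+_; _*_; _∸_; _≤_; _<_; _<?_; z≤n; s≤s; _⊓_)
import Data.Nat.Properties
open Data.Nat.Properties
  using (≤-reflexive; ≤-trans; ≤-antisym; ≮⇒≥; <⇒≱; ≰⇒>; m≤n+m; +-suc; +-comm; +-identityʳ;
         +-monoˡ-≤; +-monoʳ-≤; +-cancelʳ-≤; m⊓n≤m; m⊓n≤n)
open import Data.Product using (Σ; ∃; ∃₂; _×_; _,_; proj₁; proj₂)
open import Data.Sum using (_⊎_; inj₁; inj₂)
import Data.Sum
open import Data.Vec using ([]; _∷_; _++_; here; there; tabulate)
open import Data.Vec.Properties using (lookup⇒[]=; []=⇒lookup; lookup∘tabulate)
open import Function using (_∘′_; case_of_)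
open import Function.Bundles using (_⇔_; mk⇔; module Equivalence)
import Function.Properties.Equivalence
open import Level using (Level)
open import Relation.Binary.PropositionalEquality
open import Relation.Nullary using (¬_; Dec; yes; no; does)
open import Relation.Nullary.Decidable
  using (toWitness; toWitnessFalse; dec-true; dec-false; _×-dec_; _→-dec_; ¬?)
import Relation.Nullary.Decidable as Dec
open import Relation.Unary using (Pred; Decidable)

∣p++q∣≡∣p∣+∣q∣ : ∀ {m n} (p : Subset m) (q : Subset n) → ∣ p ++ q ∣ ≡ ∣ p ∣ + ∣ q ∣
∣p++q∣≡∣p∣+∣q∣ []            q = refl
∣p++q∣≡∣p∣+∣q∣ (inside  ∷ p) q = cong suc (∣p++q∣≡∣p∣+∣q∣ p q)
∣p++q∣≡∣p∣+∣q∣ (outside ∷ p) q = ∣p++q∣≡∣p∣+∣q∣ p q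

∣p++⊥∣≡∣p∣ : ∀ {m} n (p : Subset m) → ∣ p ++ ⊥ {n} ∣ ≡ ∣ p ∣
∣p++⊥∣≡∣p∣ n p = trans (∣p++q∣≡∣p∣+∣q∣ p ⊥) (trans (cong (∣ p ∣ +_) (∣⊥∣≡0 n)) (+-identityʳ ∣ p ∣))

∣p∪q∣≤∣p∣+∣q∣ : ∀ {n} (p q : Subset n) → ∣ p ∪ q ∣ ≤ ∣ p ∣ + ∣ q ∣
∣p∪q∣≤∣p∣+∣q∣ []            []            = z≤n
∣p∪q∣≤∣p∣+∣q∣ (inside  ∷ p) (s       ∷ q) =
  s≤s (≤-trans (∣p∪q∣≤∣p∣+∣q∣ p q) (+-monoʳ-≤ ∣ p ∣ (∣p∣≤∣x∷p∣ s q)))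
∣p∪q∣≤∣p∣+∣q∣ (outside ∷ p) (outside ∷ q) = ∣p∪q∣≤∣p∣+∣q∣ p q
∣p∪q∣≤∣p∣+∣q∣ (outside ∷ p) (inside  ∷ q) =
  subst (suc ∣ p ∪ q ∣ ≤_) (sym (+-suc ∣ p ∣ ∣ q ∣)) (s≤s (∣p∪q∣≤∣p∣+∣q∣ p q))

++-⊆ : ∀ {m n} {p : Subset m} {q : Subset n} {r : Subset (m + n)} →
       (∀ {i} → i ∈ p → i ↑ˡ n ∈ r) → (∀ {j} → j ∈ q → m ↑ʳ j ∈ r) → p ++ q ⊆ r
++-⊆ {p = []}    hp hq x∈q = hq x∈q
++-⊆ {p = _ ∷ p} {r = _ ∷ r} hp hq here = hp here
++-⊆ {p = _ ∷ p} {r = _ ∷ r} hp hq (there x∈) =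
  there (++-⊆ (λ i∈p → drop-there (hp (there i∈p))) (λ j∈q → drop-there (hq j∈q)) x∈)

∣p∪⁅x⁆∣≤∣p∣+1 : ∀ {n} (p : Subset n) (x : Fin n) → ∣ p ∪ ⁅ x ⁆ ∣ ≤ ∣ p ∣ + 1
∣p∪⁅x⁆∣≤∣p∣+1 p x = subst (∣ p ∪ ⁅ x ⁆ ∣ ≤_) (cong (∣ p ∣ +_) (∣⁅x⁆∣≡1 x)) (∣p∪q∣≤∣p∣+∣q∣ p ⁅ x ⁆)

x∈p∪⁅y⁆∧x≢y⇒x∈p : ∀ {n} {p : Subset n} {x y} → x ∈ p ∪ ⁅ y ⁆ → x ≢ y → x ∈ p
x∈p∪⁅y⁆∧x≢y⇒x∈p {p = p} {y = y} x∈ x≢y with x∈p∪q⁻ p ⁅ y ⁆ x∈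
... | inj₁ x∈p = x∈p
... | inj₂ x∈y = ⊥-elim (x≢y (x∈⁅y⁆⇒x≡y y x∈y))

∣⁅x⁆∪⁅y⁆∣≡2 : ∀ {n} {x y : Fin n} → x ≢ y → ∣ ⁅ x ⁆ ∪ ⁅ y ⁆ ∣ ≡ 2
∣⁅x⁆∪⁅y⁆∣≡2 {x = x} {y} x≢y = ≤-antisym
  (subst (∣ ⁅ x ⁆ ∪ ⁅ y ⁆ ∣ ≤_) (cong₂ _+_ (∣⁅x⁆∣≡1 x) (∣⁅x⁆∣≡1 y)) (∣p∪q∣≤∣p∣+∣q∣ ⁅ x ⁆ ⁅ y ⁆))
  (subst (_< ∣ ⁅ x ⁆ ∪ ⁅ y ⁆ ∣) (∣⁅x⁆∣≡1 x)
    (p⊂q⇒∣p∣<∣q∣ (p⊆p∪q ⁅ y ⁆ , y , q⊆p∪q ⁅ x ⁆ ⁅ y ⁆ (x∈⁅x⁆ y) , x≢y ∘′ sym ∘′ x∈⁅y⁆⇒x≡y x)))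

∈-++⁺ˡ : ∀ {m n} {p : Subset m} (q : Subset n) {x} → x ∈ p → x ↑ˡ n ∈ p ++ q
∈-++⁺ˡ q here      = here
∈-++⁺ˡ q (there x) = there (∈-++⁺ˡ q x)

∈-++⁻ʳ : ∀ {m n} (p : Subset m) {q : Subset n} {x} → m ↑ʳ x ∈ p ++ q → x ∈ q
∈-++⁻ʳ []      x∈ = x∈
∈-++⁻ʳ (_ ∷ p) x∈ = ∈-++⁻ʳ p (drop-there x∈)

module _ {ℓ : Level} {n : ℕ} {P : Pred (Fin n) ℓ} where

  ⟪_⟫ : Decidable P → Subset n
  ⟪ P? ⟫ = tabulate (λ x → does (P? x))

  ∈⟪⟫⁺ : (P? : Decidable P) {x : Fin n} → P x → x ∈ ⟪ P? ⟫
  ∈⟪⟫⁺ P? {x} px = lookup⇒[]= x ⟪ P? ⟫ (trans (lookup∘tabulate _ x) (dec-true (P? x) px))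

  ∈⟪⟫⁻ : (P? : Decidable P) {x : Fin n} → x ∈ ⟪ P? ⟫ → P x
  ∈⟪⟫⁻ P? {x} x∈ with P? x | trans (sym (lookup∘tabulate _ x)) ([]=⇒lookup x∈)
  ... | yes px | _ = px
  ... | no _   | ()

nbhd : ∀ {n} → Adj n → Fin n → Subset n
nbhd A i = tabulate (A i)

∈nbhd⁻ : ∀ {n} (A : Adj n) {i j} → j ∈ nbhd A i → A i j ≡ true
∈nbhd⁻ A {i} {j} j∈ = trans (sym (lookup∘tabulate (A i) j)) ([]=⇒lookup j∈)

closedNbhd : ∀ {n} → Adj n → Fin n → Subset n
closedNbhd A i = nbhd A i ∪ ⁅ i ⁆

∈closedNbhd⁻ : ∀ {n} (A : Adj n) {i j} → j ∈ closedNbhd A i → A i j ≡ true ⊎ j ≡ i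
∈closedNbhd⁻ A {i} j∈ = Data.Sum.map (∈nbhd⁻ A) (x∈⁅y⁆⇒x≡y i) (x∈p∪q⁻ (nbhd A i) ⁅ i ⁆ j∈)

deg<∣closedNbhd∣ : ∀ {n} (A : Adj n) i → A i i ≡ false → deg A i < ∣ closedNbhd A i ∣
deg<∣closedNbhd∣ A i aii = p⊂q⇒∣p∣<∣q∣
  (p⊆p∪q ⁅ i ⁆ , i , q⊆p∪q (nbhd A i) ⁅ i ⁆ (x∈⁅x⁆ i) ,
   λ i∈ → case trans (sym (∈nbhd⁻ A i∈)) aii of λ ())

minDeg≤deg : ∀ {n} (A : Adj n) i → minDeg A ≤ deg A i
minDeg≤deg {suc n} A i = foldr-⊓-≤ (allFinL (suc n)) (∈-allFin i)
  where
  foldr-⊓-≤ : ∀ xs {i} → i ∈ₗ xs → foldr _⊓_ (deg A zero) (mapₗ (deg A) xs) ≤ deg A i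
  foldr-⊓-≤ (x ∷ₗ xs) (Any.here refl) = m⊓n≤m (deg A x) _
  foldr-⊓-≤ (x ∷ₗ xs) (Any.there i∈) = ≤-trans (m⊓n≤n (deg A x) _) (foldr-⊓-≤ xs i∈)

walk-closed : ∀ {ℓ n} {A : Adj n} (P : Pred (Fin n) ℓ) → (∀ {x y} → A x y ≡ true → P x → P y) →
              ∀ {a b} → Walk A a b → P a → P b
walk-closed P closed here         pa = pa
walk-closed P closed (step axy w) pa = walk-closed P closed w (closed axy pa)

connected⇒neighbour : ∀ {n} {A : Adj (2 + n)} → Connected A → ∀ x → ∃ λ y → A x y ≡ true
connected⇒neighbour {A = A} conn x = leave (conn x (another x)) (another≢ x)
  where
  another : Fin (2 + _) → Fin (2 + _)
  another zero    = suc zero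
  another (suc _) = zero
  another≢ : ∀ x → another x ≢ x
  another≢ zero    ()
  another≢ (suc _) ()
  leave : ∀ {t} → Walk A x t → t ≢ x → ∃ λ y → A x y ≡ true
  leave here               t≢x = ⊥-elim (t≢x refl)
  leave (step {v = y} axy _) _ = y , axy

module Propagation {N : ℕ} (H : Adj N) where

  Forces : Subset N → Fin N → Fin N → Set
  Forces B u v = u ∈ B × v ∉ B × H u v ≡ true × (∀ w → H u w ≡ true → w ≢ v → w ∈ B)

  forces? : (B : Subset N) → Dec (∃₂ (Forces B))
  forces? B = any? λ u → any? λ v → (u ∈? B) ×-dec ¬? (v ∈? B) ×-dec (H u v Bool.≟ true)
    ×-dec all? (λ w → (H u w Bool.≟ true) →-dec ¬? (w ≟ v) →-dec (w ∈? B))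

  Stalled : Subset N → Set
  Stalled B = ¬ ∃₂ (Forces B)

  propagate : ℕ → Subset N → Subset N
  propagate zero    B = B
  propagate (suc k) B with forces? B
  ... | yes (_ , v , _) = propagate k (B ∪ ⁅ v ⁆)
  ... | no _            = B

  propagate-preserves : ∀ {ℓ} (P : Pred (Subset N) ℓ) →
    (∀ {B u v} → Forces B u v → P B → P (B ∪ ⁅ v ⁆)) → ∀ k {B} → P B → P (propagate k B)
  propagate-preserves P preserved zero    pB = pB
  propagate-preserves P preserved (suc k) {B} pB with forces? B
  ... | yes (_ , _ , F) = propagate-preserves P preserved k (preserved F pB)
  ... | no _            = pB

  forced-⊂ : ∀ {B u v} → Forces B u v → B ⊂ B ∪ ⁅ v ⁆
  forced-⊂ {B} {v = v} (_ , v∉B , _) = p⊆p∪q ⁅ v ⁆ , v , q⊆p∪q B ⁅ v ⁆ (x∈⁅x⁆ v) , v∉B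

  propagate-progress : ∀ k B →
    B ⊆ propagate k B × (Stalled (propagate k B) ⊎ ∣ B ∣ + k ≤ ∣ propagate k B ∣)
  propagate-progress zero    B = (λ x∈B → x∈B) , inj₂ (≤-reflexive (+-identityʳ ∣ B ∣))
  propagate-progress (suc k) B with forces? B
  ... | no stalled = (λ x∈B → x∈B) , inj₁ stalled
  ... | yes (_ , v , F) with propagate-progress k (B ∪ ⁅ v ⁆)
  ...   | B′⊆ , progress = ⊆-trans (proj₁ (forced-⊂ F)) B′⊆ , Data.Sum.map₂ grow progress
    where
    grow : ∣ B ∪ ⁅ v ⁆ ∣ + k ≤ ∣ propagate k (B ∪ ⁅ v ⁆) ∣ →
           ∣ B ∣ + suc k ≤ ∣ propagate k (B ∪ ⁅ v ⁆) ∣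
    grow = ≤-trans (≤-reflexive (+-suc ∣ B ∣ k)) ∘′ ≤-trans (+-monoˡ-≤ k (p⊂q⇒∣p∣<∣q∣ (forced-⊂ F)))

  black⊆stalled : ∀ {S B} → S ⊆ B → Stalled B → ∀ {v} → Black H S v → v ∈ B
  black⊆stalled S⊆B stalled (init v∈S) = S⊆B v∈S
  black⊆stalled {B = B} S⊆B stalled {v} (force {u} bu huv rest) with v ∈? B
  ... | yes v∈B = v∈B
  ... | no  v∉B = ⊥-elim (stalled (u , v , black⊆stalled S⊆B stalled bu , v∉B , huv ,
                                   λ w huw w≢v → black⊆stalled S⊆B stalled (rest w huw w≢v)))

  zeroForcing⇔propagate-full : ∀ S → IsZeroForcingSet H S ⇔ (∀ v → v ∈ propagate N S)
  zeroForcing⇔propagate-full S = mk⇔ complete sound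
    where
    complete : IsZeroForcingSet H S → ∀ v → v ∈ propagate N S
    complete zf v with propagate-progress N S
    ... | S⊆ , inj₁ stalled = black⊆stalled S⊆ stalled (zf v)
    ... | _  , inj₂ big     = subst (v ∈_) (sym (∣p∣≡n⇒p≡⊤ {p = propagate N S} full)) ∈⊤
      where
      full : ∣ propagate N S ∣ ≡ N
      full = ≤-antisym (∣p∣≤n (propagate N S)) (≤-trans (m≤n+m N ∣ S ∣) big)
    sound : (∀ v → v ∈ propagate N S) → IsZeroForcingSet H S
    sound full v = propagate-preserves (λ B → ∀ {x} → x ∈ B → Black H S x) blacken N init (full v)
      where
      blacken : ∀ {B u v} → Forces B u v →
                (∀ {x} → x ∈ B → Black H S x) → ∀ {x} → x ∈ B ∪ ⁅ v ⁆ → Black H S x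
      blacken {B} {v = v} (u∈B , _ , huv , rest) B⊆ x∈ with x∈p∪q⁻ B ⁅ v ⁆ x∈
      ... | inj₁ x∈B = B⊆ x∈B
      ... | inj₂ x∈v rewrite x∈⁅y⁆⇒x≡y v x∈v =
        force (B⊆ u∈B) huv (λ w huw w≢v → B⊆ (rest w huw w≢v))

  zeroForcing? : ∀ S → Dec (IsZeroForcingSet H S)
  zeroForcing? S = Dec.map (Function.Properties.Equivalence.sym (zeroForcing⇔propagate-full S))
                           (all? λ v → v ∈? propagate N S)

data SplitView (m n : ℕ) : Fin (m + n) → Set where
  left  : ∀ i → SplitView m n (i ↑ˡ n)
  right : ∀ j → SplitView m n (m ↑ʳ j)

splitView : ∀ m n x → SplitView m n x
splitView m n x with splitAt m x | join-splitAt m n x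
... | inj₁ i | refl = left i
... | inj₂ j | refl = right j

↑ˡ≢↑ʳ : ∀ {m n} (i : Fin m) (j : Fin n) → i ↑ˡ n ≢ m ↑ʳ j
↑ˡ≢↑ʳ {m} {n} i j eq
  with trans (sym (splitAt-↑ˡ m i n)) (trans (cong (splitAt m) eq) (splitAt-↑ʳ m n j))
... | ()

module _ {n} (A : Adj n) (f : Fin n → Fin n) where

  functigraph-G₁ : ∀ i j → functigraph A f (i ↑ˡ n) (j ↑ˡ n) ≡ A i j
  functigraph-G₁ i j rewrite splitAt-↑ˡ n i n | splitAt-↑ˡ n j n = refl

  functigraph-G₂ : ∀ i j → functigraph A f (n ↑ʳ i) (n ↑ʳ j) ≡ A i j
  functigraph-G₂ i j rewrite splitAt-↑ʳ n n i | splitAt-↑ʳ n n j = refl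

  functigraph-f : ∀ i → functigraph A f (i ↑ˡ n) (n ↑ʳ f i) ≡ true
  functigraph-f i rewrite splitAt-↑ˡ n i n | splitAt-↑ʳ n n (f i) with f i ≟ f i
  ... | yes _  = refl
  ... | no fi≢fi = ⊥-elim (fi≢fi refl)

  functigraph-f⁻¹ : ∀ i → functigraph A f (n ↑ʳ f i) (i ↑ˡ n) ≡ true
  functigraph-f⁻¹ i rewrite splitAt-↑ˡ n i n | splitAt-↑ʳ n n (f i) with f i ≟ f i
  ... | yes _  = refl
  ... | no fi≢fi = ⊥-elim (fi≢fi refl)

  functigraph-G₂G₁⁻ : ∀ {i j} → functigraph A f (n ↑ʳ j) (i ↑ˡ n) ≡ true → f i ≡ j
  functigraph-G₂G₁⁻ {i} {j} e rewrite splitAt-↑ˡ n i n | splitAt-↑ʳ n n j with f i ≟ j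
  functigraph-G₂G₁⁻ e | yes fi≡j = fi≡j
  functigraph-G₂G₁⁻ () | no _

module FunctigraphLowerBound {n : ℕ} (A : Adj n) (f : Fin n → Fin n)
         (irrefl : ∀ i → A i i ≡ false) (conn : Connected A) where

  private
    H = functigraph A f
    δ = minDeg A

  open Propagation H
  open Data.Nat.Properties.≤-Reasoning

  Active : Subset (n + n) → Fin (n + n) → Set
  Active B x = ∃ λ y → H x y ≡ true × y ∉ B

  active? : ∀ B → Decidable (Active B)
  active? B x = any? λ y → (H x y Bool.≟ true) ×-dec ¬? (y ∈? B)

  active-antitone : ∀ {B B′ x} → B ⊆ B′ → Active B′ x → Active B x
  active-antitone B⊆B′ (y , hxy , y∉B′) = y , hxy , y∉B′ ∘′ B⊆B′

  forcer-inactive : ∀ {B u v} → Forces B u v → ¬ Active (B ∪ ⁅ v ⁆) u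
  forcer-inactive {B} {v = v} (_ , _ , _ , rest) (y , huy , y∉) with y ≟ v
  ... | yes refl = y∉ (q⊆p∪q B ⁅ v ⁆ (x∈⁅x⁆ v))
  ... | no y≢v   = y∉ (p⊆p∪q ⁅ v ⁆ (rest y huy y≢v))

  G₁ : Subset (n + n)
  G₁ = ⊤ {n} ++ ⊥ {n}

  ∣G₁∣≡n : ∣ G₁ ∣ ≡ n
  ∣G₁∣≡n = trans (∣p++⊥∣≡∣p∣ n (⊤ {n})) (∣⊤∣≡n n)

  ↑ˡ∈G₁ : ∀ i → i ↑ˡ n ∈ G₁
  ↑ˡ∈G₁ i = ∈-++⁺ˡ ⊥ ∈⊤

  ↑ʳ∉G₁ : ∀ j → n ↑ʳ j ∉ G₁
  ↑ʳ∉G₁ j j∈ = ∉⊥ (∈-++⁻ʳ (⊤ {n}) j∈)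

  Φ : Subset (n + n) → Subset (n + n)
  Φ B = B ∩ (G₁ ∪ ⟪ active? B ⟫)

  Φ⁺ᴳ : ∀ {B x} → x ∈ B → x ∈ G₁ → x ∈ Φ B
  Φ⁺ᴳ x∈B x∈G₁ = x∈p∩q⁺ (x∈B , x∈p∪q⁺ (inj₁ x∈G₁))

  Φ⁺ᵃ : ∀ {B x} → x ∈ B → Active B x → x ∈ Φ B
  Φ⁺ᵃ {B} x∈B act = x∈p∩q⁺ (x∈B , x∈p∪q⁺ (inj₂ (∈⟪⟫⁺ (active? B) act)))

  Φ⁻ : ∀ {B x} → x ∈ Φ B → x ∈ B × (x ∈ G₁ ⊎ Active B x)
  Φ⁻ {B} x∈ with x∈p∩q⁻ B _ x∈
  ... | x∈B , x∈′ = x∈B , Data.Sum.map₂ (∈⟪⟫⁻ (active? B)) (x∈p∪q⁻ G₁ _ x∈′)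

  Φ-nonincreasing : ∀ {B j v} → Forces B (n ↑ʳ j) v → ∣ Φ (B ∪ ⁅ v ⁆) ∣ ≤ ∣ Φ B ∣
  Φ-nonincreasing {B} {j} {v} F@(u∈B , v∉B , huv , _) = begin
    ∣ Φ (B ∪ ⁅ v ⁆) ∣     ≤⟨ p⊆q⇒∣p∣≤∣q∣ Φ′⊆ ⟩
    ∣ (Φ B - u) ∪ ⁅ v ⁆ ∣ ≤⟨ ∣p∪⁅x⁆∣≤∣p∣+1 (Φ B - u) v ⟩
    ∣ Φ B - u ∣ + 1       ≡⟨ +-comm ∣ Φ B - u ∣ 1 ⟩
    suc ∣ Φ B - u ∣       ≤⟨ x∈p⇒∣p-x∣<∣p∣ (Φ⁺ᵃ u∈B (v , huv , v∉B)) ⟩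
    ∣ Φ B ∣               ∎
    where
    u = n ↑ʳ j
    Φ′⊆ : Φ (B ∪ ⁅ v ⁆) ⊆ (Φ B - u) ∪ ⁅ v ⁆
    Φ′⊆ {x} x∈ with x ≟ v | Φ⁻ x∈
    ... | yes refl | _           = q⊆p∪q (Φ B - u) ⁅ v ⁆ (x∈⁅x⁆ v)
    ... | no x≢v   | x∈B′ , side = p⊆p∪q ⁅ v ⁆ (x∈p∧x≢y⇒x∈p-y x∈ΦB x≢u)
      where
      x∈B = x∈p∪⁅y⁆∧x≢y⇒x∈p x∈B′ x≢v
      x∈ΦB = Data.Sum.[ Φ⁺ᴳ x∈B , Φ⁺ᵃ x∈B ∘′ active-antitone (p⊆p∪q ⁅ v ⁆) ] side
      x≢u : x ≢ u
      x≢u refl = Data.Sum.[ ↑ʳ∉G₁ j , forcer-inactive F ] side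

  closedNbhd-black : ∀ {B i v} → Forces B (i ↑ˡ n) v →
                     ∀ {k} → k ∈ closedNbhd A i → k ↑ˡ n ≢ v → k ↑ˡ n ∈ B
  closedNbhd-black {i = i} (u∈B , _ , _ , rest) k∈ k≢v with ∈closedNbhd⁻ A k∈
  ... | inj₁ aik = rest _ (trans (functigraph-G₁ A f i _) aik) k≢v
  ... | inj₂ refl = u∈B

  activeInG₂ : ∀ {B i k} → Forces B (i ↑ˡ n) (k ↑ˡ n) → ∃ λ j → n ↑ʳ j ∈ B × Active B (n ↑ʳ j)
  activeInG₂ {B} {i} {k} (_ , v∉B , _ , rest)
    with any? (λ j → (n ↑ʳ j ∈? B) ×-dec active? B (n ↑ʳ j))
  ... | yes found = found
  ... | no none   = ⊥-elim (none (f k , fk∈B , k ↑ˡ n , functigraph-f⁻¹ A f k , v∉B))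
    where
    spread : ∀ {a b} → A a b ≡ true → n ↑ʳ a ∈ B → n ↑ʳ b ∈ B
    spread {a} {b} aab a∈B with n ↑ʳ b ∈? B
    ... | yes b∈B = b∈B
    ... | no  b∉B = ⊥-elim (none (a , a∈B , n ↑ʳ b , trans (functigraph-G₂ A f a b) aab , b∉B))
    fk∈B : n ↑ʳ f k ∈ B
    fk∈B = walk-closed (λ a → n ↑ʳ a ∈ B) spread (conn (f i) (f k))
             (rest (n ↑ʳ f i) (functigraph-f A f i) (↑ˡ≢↑ʳ k (f i) ∘′ sym))

  forceFromG₁⇒deg<∣Φ∣ : ∀ {B i v} → Forces B (i ↑ˡ n) v → deg A i < ∣ Φ B ∣
  forceFromG₁⇒deg<∣Φ∣ {B} {i} {v} F with splitView n n v
  ... | right j = begin-strict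
    deg A i                    <⟨ deg<∣closedNbhd∣ A i (irrefl i) ⟩
    ∣ closedNbhd A i ∣          ≡⟨ sym (∣p++⊥∣≡∣p∣ n (closedNbhd A i)) ⟩
    ∣ closedNbhd A i ++ ⊥ ∣     ≤⟨ p⊆q⇒∣p∣≤∣q∣ (++-⊆ G₁-part (⊥-elim ∘′ ∉⊥)) ⟩
    ∣ Φ B ∣                    ∎
    where
    G₁-part : ∀ {k} → k ∈ closedNbhd A i → k ↑ˡ n ∈ Φ B
    G₁-part {k} k∈ = Φ⁺ᴳ (closedNbhd-black F k∈ (↑ˡ≢↑ʳ k j)) (↑ˡ∈G₁ _)
  ... | left k with activeInG₂ F
  ...   | j , j∈B , j-active = begin-strict
    deg A i               <⟨ deg<∣closedNbhd∣ A i (irrefl i) ⟩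
    ∣ closedNbhd A i ∣     ≤⟨ +-cancelʳ-≤ 1 _ _ counted ⟩
    ∣ Φ B ∣               ∎
    where
    covered : closedNbhd A i ++ ⁅ j ⁆ ⊆ Φ B ∪ ⁅ k ↑ˡ n ⁆
    covered = ++-⊆ G₁-part G₂-part
      where
      G₁-part : ∀ {m} → m ∈ closedNbhd A i → m ↑ˡ n ∈ Φ B ∪ ⁅ k ↑ˡ n ⁆
      G₁-part {m} m∈ with m ≟ k
      ... | yes refl = q⊆p∪q (Φ B) ⁅ k ↑ˡ n ⁆ (x∈⁅x⁆ (k ↑ˡ n))
      ... | no m≢k   = p⊆p∪q ⁅ k ↑ˡ n ⁆
                         (Φ⁺ᴳ (closedNbhd-black F m∈ (m≢k ∘′ ↑ˡ-injective n m k)) (↑ˡ∈G₁ _))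
      G₂-part : ∀ {m} → m ∈ ⁅ j ⁆ → n ↑ʳ m ∈ Φ B ∪ ⁅ k ↑ˡ n ⁆
      G₂-part m∈ rewrite x∈⁅y⁆⇒x≡y j m∈ = p⊆p∪q ⁅ k ↑ˡ n ⁆ (Φ⁺ᵃ j∈B j-active)
    counted : ∣ closedNbhd A i ∣ + 1 ≤ ∣ Φ B ∣ + 1
    counted = begin
      ∣ closedNbhd A i ∣ + 1             ≡⟨ cong (_ +_) (sym (∣⁅x⁆∣≡1 j)) ⟩
      ∣ closedNbhd A i ∣ + ∣ ⁅ j ⁆ ∣     ≡⟨ sym (∣p++q∣≡∣p∣+∣q∣ (closedNbhd A i) ⁅ j ⁆) ⟩
      ∣ closedNbhd A i ++ ⁅ j ⁆ ∣        ≤⟨ p⊆q⇒∣p∣≤∣q∣ covered ⟩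
      ∣ Φ B ∪ ⁅ k ↑ˡ n ⁆ ∣               ≤⟨ ∣p∪⁅x⁆∣≤∣p∣+1 (Φ B) (k ↑ˡ n) ⟩
      ∣ Φ B ∣ + 1                        ∎

  Φ-bounded-preserved : ∀ {B u v} → Forces B u v → ∣ Φ B ∣ ≤ δ → ∣ Φ (B ∪ ⁅ v ⁆) ∣ ≤ δ
  Φ-bounded-preserved {u = u} F ∣Φ∣≤δ with splitView n n u
  ... | right j = ≤-trans (Φ-nonincreasing F) ∣Φ∣≤δ
  ... | left i  = ⊥-elim (<⇒≱ (≤-trans (s≤s (minDeg≤deg A i)) (forceFromG₁⇒deg<∣Φ∣ F)) ∣Φ∣≤δ)

  minDeg<∣zeroForcingSet∣ : Fin n → ∀ S → IsZeroForcingSet H S → δ < ∣ S ∣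
  minDeg<∣zeroForcingSet∣ x₀ S zf = ≰⇒> λ ∣S∣≤δ → <⇒≱ δ<n (≤-trans n≤∣ΦB∣ (∣ΦB∣≤δ ∣S∣≤δ))
    where
    B = propagate (n + n) S
    n≤∣ΦB∣ : n ≤ ∣ Φ B ∣
    n≤∣ΦB∣ = subst (_≤ ∣ Φ B ∣) ∣G₁∣≡n
      (p⊆q⇒∣p∣≤∣q∣ λ {x} → Φ⁺ᴳ (Equivalence.to (zeroForcing⇔propagate-full S) zf x))
    ∣ΦB∣≤δ : ∣ S ∣ ≤ δ → ∣ Φ B ∣ ≤ δ
    ∣ΦB∣≤δ ∣S∣≤δ = propagate-preserves (λ B → ∣ Φ B ∣ ≤ δ) Φ-bounded-preserved (n + n)
                     (≤-trans (p⊆q⇒∣p∣≤∣q∣ (p∩q⊆p S _)) ∣S∣≤δ)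
    δ<n : δ < n
    δ<n = begin-strict
      δ                   ≤⟨ minDeg≤deg A x₀ ⟩
      deg A x₀            <⟨ deg<∣closedNbhd∣ A x₀ (irrefl x₀) ⟩
      ∣ closedNbhd A x₀ ∣ ≤⟨ ∣p∣≤n (closedNbhd A x₀) ⟩
      n                   ∎

zeroForcingSet-2n∸2 : ∀ {n} (A : Adj n) (f : Fin n → Fin n) → IsSimple A →
                      ∀ i {w} → A (f i) w ≡ true →
                      ∃ λ S → IsZeroForcingSet (functigraph A f) S × ∣ S ∣ ≡ 2 * n ∸ 2
zeroForcingSet-2n∸2 {n} A f simple i {w} fi~w = S , zeroForcing , ∣S∣
  where
  H = functigraph A f
  open IsSimple simple renaming (sym to A-sym)
  a = i ↑ˡ n
  b = n ↑ʳ f i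
  S = ∁ (⁅ a ⁆ ∪ ⁅ b ⁆)

  ∈S : ∀ {x} → x ≢ a → x ≢ b → x ∈ S
  ∈S {x} x≢a x≢b = x∉p⇒x∈∁p λ x∈ →
    Data.Sum.[ x≢a ∘′ x∈⁅y⁆⇒x≡y a , x≢b ∘′ x∈⁅y⁆⇒x≡y b ] (x∈p∪q⁻ ⁅ a ⁆ ⁅ b ⁆ x∈)

  no-loop : ∀ {x} → A x x ≢ true
  no-loop {x} axx = case trans (sym axx) (irrefl x) of λ ()

  b-black : Black H S b
  b-black = force (init (∈S (↑ˡ≢↑ʳ i w ∘′ sym) (w≢fi ∘′ ↑ʳ-injective n w (f i))))
                  (trans (functigraph-G₂ A f w (f i)) (trans (A-sym w (f i)) fi~w))
                  others
    where
    w≢fi : w ≢ f i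
    w≢fi refl = no-loop fi~w
    others : ∀ y → H (n ↑ʳ w) y ≡ true → y ≢ b → Black H S y
    others y hwy y≢b with y ≟ a
    ... | yes refl = ⊥-elim (w≢fi (sym (functigraph-G₂G₁⁻ A f hwy)))
    ... | no y≢a   = init (∈S y≢a y≢b)

  a-black : Black H S a
  a-black = force b-black (functigraph-f⁻¹ A f i) others
    where
    others : ∀ y → H b y ≡ true → y ≢ a → Black H S y
    others y hby y≢a with y ≟ b
    ... | yes refl = ⊥-elim (no-loop (trans (sym (functigraph-G₂ A f (f i) (f i))) hby))
    ... | no y≢b   = init (∈S y≢a y≢b)

  zeroForcing : IsZeroForcingSet H S
  zeroForcing x with x ≟ a | x ≟ b
  ... | yes refl | _        = a-black
  ... | no _     | yes refl = b-black
  ... | no x≢a   | no x≢b   = init (∈S x≢a x≢b)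

  ∣S∣ : ∣ S ∣ ≡ 2 * n ∸ 2
  ∣S∣ = begin
    ∣ S ∣                         ≡⟨ ∣∁p∣≡n∸∣p∣ (⁅ a ⁆ ∪ ⁅ b ⁆) ⟩
    (n + n) ∸ ∣ ⁅ a ⁆ ∪ ⁅ b ⁆ ∣   ≡⟨ cong₂ _∸_ (cong (n +_) (sym (+-identityʳ n)))
                                               (∣⁅x⁆∪⁅y⁆∣≡2 (↑ˡ≢↑ʳ i (f i))) ⟩
    2 * n ∸ 2                     ∎
    where open ≡-Reasoning

isSimple? : ∀ {n} (A : Adj n) → Dec (IsSimple A)
isSimple? A = Dec.map′ (λ (s , r) → record { sym = s ; irrefl = r })
                       (λ s → IsSimple.sym s , IsSimple.irrefl s)
  ((all? λ i → all? λ j → A i j Bool.≟ A j i) ×-dec all? λ i → A i i Bool.≟ false)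

open FunctigraphLowerBound using (minDeg<∣zeroForcingSet∣)

functigraph-zeroForcing-bounds :
  (n : ℕ) (A : Adj n) (f : Fin n → Fin n) → 3 ≤ n → IsSimple A → Connected A →
  ((S : Subset (n + n)) → IsZeroForcingSet (functigraph A f) S → 1 + minDeg A ≤ ∣ S ∣)
  × Σ (Subset (n + n)) (λ S → IsZeroForcingSet (functigraph A f) S × ∣ S ∣ ≤ 2 * n ∸ 2)
functigraph-zeroForcing-bounds (suc (suc _)) A f (s≤s (s≤s _)) simple conn
  with zeroForcingSet-2n∸2 A f simple zero (proj₂ (connected⇒neighbour conn (f zero)))
... | S , zf , ∣S∣≡ =
  minDeg<∣zeroForcingSet∣ A f (IsSimple.irrefl simple) conn zero , S , zf , ≤-reflexive ∣S∣≡

module Path₃ where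

  pattern v₀ = zero
  pattern v₁ = suc zero
  pattern v₂ = suc (suc zero)

  P₃ : Adj 3
  P₃ v₀ v₁ = true
  P₃ v₁ v₀ = true
  P₃ v₁ v₂ = true
  P₃ v₂ v₁ = true
  P₃ _  _  = false

  P₃-simple : IsSimple P₃
  P₃-simple = toWitness {a? = isSimple? P₃} _

  P₃-connected : Connected P₃
  P₃-connected v₀ v₀ = here
  P₃-connected v₀ v₁ = step refl here
  P₃-connected v₀ v₂ = step {v = v₁} refl (step refl here)
  P₃-connected v₁ v₀ = step refl here
  P₃-connected v₁ v₁ = here
  P₃-connected v₁ v₂ = step refl here
  P₃-connected v₂ v₀ = step {v = v₁} refl (step refl here)
  P₃-connected v₂ v₁ = step refl here
  P₃-connected v₂ v₂ = here

  -- the two copies of an end vertex of the path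
  S₂ : Subset 6
  S₂ = inside ∷ outside ∷ outside ∷ inside ∷ outside ∷ outside ∷ []

  S₂-zeroForcing : IsZeroForcingSet (functigraph P₃ (λ x → x)) S₂
  S₂-zeroForcing = toWitness {a? = Propagation.zeroForcing? (functigraph P₃ (λ x → x)) S₂} _

  P₃-attains-lowerBound : Σ ℕ λ n → Σ (Adj n) λ A → Σ (Fin n → Fin n) λ f →
    3 ≤ n × IsSimple A × Connected A × IsZeroForcingNumber (functigraph A f) (1 + minDeg A)
  P₃-attains-lowerBound = 3 , P₃ , (λ x → x) , s≤s (s≤s (s≤s z≤n)) , P₃-simple , P₃-connected ,
    (S₂ , S₂-zeroForcing , refl) ,
    minDeg<∣zeroForcingSet∣ P₃ (λ x → x) (IsSimple.irrefl P₃-simple) P₃-connected zero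

module Triangle where

  K₃ : Adj 3
  K₃ i j = not (does (i ≟ j))

  K₃-simple : IsSimple K₃
  K₃-simple = toWitness {a? = isSimple? K₃} _

  K₃-connected : Connected K₃
  K₃-connected i j with i ≟ j
  ... | yes refl = here
  ... | no i≢j   = step (cong not (dec-false (i ≟ j) i≢j)) here

  noSmallZeroForcingSet : ¬ ∃ λ S → ∣ S ∣ < 4 × IsZeroForcingSet (functigraph K₃ (λ _ → zero)) S
  noSmallZeroForcingSet = toWitnessFalse
    {a? = anySubset? λ S → (∣ S ∣ <? 4) ×-dec Propagation.zeroForcing? (functigraph K₃ (λ _ → zero)) S}
    _

  K₃-attains-upperBound : Σ ℕ λ n → Σ (Adj n) λ A → Σ (Fin n → Fin n) λ f →
    3 ≤ n × IsSimple A × Connected A × IsZeroForcingNumber (functigraph A f) (2 * n ∸ 2)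
  K₃-attains-upperBound = 3 , K₃ , (λ _ → zero) , s≤s (s≤s (s≤s z≤n)) , K₃-simple , K₃-connected ,
    zeroForcingSet-2n∸2 K₃ (λ _ → zero) K₃-simple zero {suc zero} refl ,
    λ S zf → ≮⇒≥ λ ∣S∣<4 → noSmallZeroForcingSet (S , ∣S∣<4 , zf)

theorem2p8 :
  ((n : ℕ) (A : Adj n) (f : Fin n → Fin n) → 3 ≤ n → IsSimple A → Connected A →
    ((S : Subset (n + n)) → IsZeroForcingSet (functigraph A f) S → 1 + minDeg A ≤ ∣ S ∣)
    × Σ (Subset (n + n)) (λ S → IsZeroForcingSet (functigraph A f) S × ∣ S ∣ ≤ 2 * n ∸ 2))
  × Σ ℕ (λ n → Σ (Adj n) (λ A → Σ (Fin n → Fin n) (λ f →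
      3 ≤ n × IsSimple A × Connected A
      × IsZeroForcingNumber (functigraph A f) (1 + minDeg A))))
  × Σ ℕ (λ n → Σ (Adj n) (λ A → Σ (Fin n → Fin n) (λ f →
      3 ≤ n × IsSimple A × Connected A
      × IsZeroForcingNumber (functigraph A f) (2 * n ∸ 2))))
theorem2p8 =
  functigraph-zeroForcing-bounds , Path₃.P₃-attains-lowerBound , Triangle.K₃-attains-upperBound
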